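{- Let $p$ be a prime, $q=p^n$ with $q\equiv 1\pmod 3$, $\delta\in\mathbb{F}_q$ a cubic nonresidue, and let $\mathbb{H}_q$ with its $\mathrm{GL}_3(\mathbb{F}_q)$-action be as in the context. Let \[ G_\gamma=\left\{\begin{bmatrix} d & y & x\\ 0 & c & b\\ 0 & 0 & d\end{bmatrix} : c,d\in\mathbb{F}_q^\times,\ b,x,y\in\mathbb{F}_q\right\} \] (the centralizer in $\mathrm{GL}_3(\mathbb{F}_q)$ of $\gamma=\begin{bmatrix} a&0&a\\0&a&0\\0&0&a\end{bmatrix}$, $a\neq 0$). Then \[ \{(u\delta^{1/3},\ v\delta^{1/3}+\delta^{2/3}) : u,v\in\mathbb{F}_q,\ u\neq 0\}\ \sqcup\ \{(\delta^{1/3}+u\delta^{2/3},\ \delta^{1/3}) : u\in\mathbb{F}_q^\times\} \] is a fundamental domain for the action of $G_\gamma$ on $\mathbb{H}_q$, i.e. it contains exactly one element of each $G_\gamma$-orbit.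
   Context: $\mathbb{F}_q(\sqrt[3]{\delta})\cong\mathbb{F}_{q^3}$ has $\mathbb{F}_q$-basis $\{1,\delta^{1/3},\delta^{2/3}\}$; write $\alpha=\alpha_1+\alpha_2\delta^{1/3}+\alpha_3\delta^{2/3}$ with $\alpha_i\in\mathbb{F}_q$. $\mathbb{H}_q=\{(\alpha,\beta)\in\mathbb{F}_q(\sqrt[3]{\delta})^2 : \alpha_2\beta_3-\alpha_3\beta_2\neq 0\}$, with $\mathrm{GL}_3(\mathbb{F}_q)$ acting by $\begin{bmatrix} a & b & c\\ d & e & f\\ r & s & t\end{bmatrix}(\alpha,\beta)=\left(\frac{a\alpha+b\beta+c}{r\alpha+s\beta+t},\frac{d\alpha+e\beta+f}{r\alpha+s\beta+t}\right)$. -}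

module Defs where

open import Level using (Level; _⊔_)
open import Data.Nat using (ℕ)
open import Data.Fin using (Fin)
open import Data.Product using (Σ; ∃; _×_; _,_)
open import Data.Sum using (_⊎_)
open import Relation.Nullary using (¬_)
open import Algebra.Bundles using (CommutativeRing)
open import Function.Bundles using (Inverse)
import Relation.Binary.PropositionalEquality as P

module _ {c ℓ : Level} (R : CommutativeRing c ℓ) where
  open CommutativeRing R

  IsFieldCR : Set (c ⊔ ℓ)
  IsFieldCR = (¬ (0# ≈ 1#)) × (∀ x → ¬ (x ≈ 0#) → ∃ λ y → x * y ≈ 1#)

  HasCard : ℕ → Set (c ⊔ ℓ)
  HasCard q = Inverse setoid (P.setoid (Fin q))

  CubicNonresidue : Carrier → Set (c ⊔ ℓ)
  CubicNonresidue δ = ¬ (∃ λ x → x * x * x ≈ δ)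

  -- Element α₁ + α₂ δ^{1/3} + α₃ δ^{2/3} of F_q(δ^{1/3}), as coordinate triple.
  record E : Set c where
    constructor ⟨_,_,_⟩
    field
      e₁ e₂ e₃ : Carrier
  open E public

  _≈E_ : E → E → Set ℓ
  α ≈E β = (e₁ α ≈ e₁ β) × (e₂ α ≈ e₂ β) × (e₃ α ≈ e₃ β)

  _+E_ : E → E → E
  α +E β = ⟨ e₁ α + e₁ β , e₂ α + e₂ β , e₃ α + e₃ β ⟩

  scal : Carrier → E
  scal a = ⟨ a , 0# , 0# ⟩

  -- multiplication in F_q[t]/(t³ - δ)
  mulE : Carrier → E → E → E
  mulE δ ⟨ a₁ , a₂ , a₃ ⟩ ⟨ b₁ , b₂ , b₃ ⟩ =
    ⟨ a₁ * b₁ + δ * (a₂ * b₃ + a₃ * b₂)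
    , a₁ * b₂ + a₂ * b₁ + δ * (a₃ * b₃)
    , a₁ * b₃ + a₂ * b₂ + a₃ * b₁ ⟩

  Pt : Set c
  Pt = E × E

  _≈P_ : Pt → Pt → Set ℓ
  (α , β) ≈P (α' , β') = (α ≈E α') × (β ≈E β')

  InH : Pt → Set ℓ
  InH (α , β) = ¬ (e₂ α * e₃ β - e₃ α * e₂ β ≈ 0#)

  record Mat3 : Set c where
    constructor mat
    field
      m₁₁ m₁₂ m₁₃ m₂₁ m₂₂ m₂₃ m₃₁ m₃₂ m₃₃ : Carrier
  open Mat3 public

  -- Acts δ g z z' :  g · z = z'  for the fractional-linear action, i.e. the
  -- denominator rα+sβ+t is nonzero and z' = (num₁/den, num₂/den).
  Acts : Carrier → Mat3 → Pt → Pt → Set ℓ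
  Acts δ g (α , β) (α' , β') =
    let lin : Carrier → Carrier → Carrier → E
        lin x y z = mulE δ (scal x) α +E (mulE δ (scal y) β +E scal z)
        den = lin (m₃₁ g) (m₃₂ g) (m₃₃ g)
    in (¬ (den ≈E scal 0#))
       × (mulE δ den α' ≈E lin (m₁₁ g) (m₁₂ g) (m₁₃ g))
       × (mulE δ den β' ≈E lin (m₂₁ g) (m₂₂ g) (m₂₃ g))

  InGγ : Mat3 → Set (c ⊔ ℓ)
  InGγ g = ∃ λ cc → ∃ λ d → ∃ λ b → ∃ λ x → ∃ λ y →
    (¬ (cc ≈ 0#)) × (¬ (d ≈ 0#)) ×
    (m₁₁ g ≈ d) × (m₁₂ g ≈ y) × (m₁₃ g ≈ x) ×
    (m₂₁ g ≈ 0#) × (m₂₂ g ≈ cc) × (m₂₃ g ≈ b) ×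
    (m₃₁ g ≈ 0#) × (m₃₂ g ≈ 0#) × (m₃₃ g ≈ d)

  SameOrbit : Carrier → Pt → Pt → Set (c ⊔ ℓ)
  SameOrbit δ z z' = ∃ λ g → InGγ g × Acts δ g z z'

  InD : Pt → Set (c ⊔ ℓ)
  InD (α , β) =
    (∃ λ u → ∃ λ v → (¬ (u ≈ 0#)) × (α ≈E ⟨ 0# , u , 0# ⟩) × (β ≈E ⟨ 0# , v , 1# ⟩))
    ⊎ (∃ λ u → (¬ (u ≈ 0#)) × (α ≈E ⟨ 0# , 1# , u ⟩) × (β ≈E ⟨ 0# , 1# , 0# ⟩))

  FundamentalDomain : Carrier → Set (c ⊔ ℓ)
  FundamentalDomain δ =
    (∀ w → InD w → InH w)
    × (∀ z → InH z → ∃ λ w → InD w × SameOrbit δ w z)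
    × (∀ w w' → InD w → InD w' → SameOrbit δ w w' → w ≈P w')

-- Every element of G_γ is upper triangular with equal outer diagonal entries d, so the
-- denominator rα + sβ + t of the action is the scalar d and the action is affine on the
-- F_q-coordinates: d·α' = d·α + y·β + x and d·β' = c·β + b.  Only the first coordinate of
-- α and β absorbs the translations x and b, so the orbit invariants live in the (δ^{1/3}, δ^{2/3})
-- coordinates: β₃ = 0 or not is preserved, β can be scaled to (v, 1) resp. (1, 0), and α then
-- shifted by a multiple of β to (u, 0) resp. (1, u).
module Submission where

open import Defs
open import Level using (Level; _⊔_)
open import Data.Nat using (ℕ; _^_; _%_)
open import Data.Nat.Primality using (Prime)
open import Relation.Binary.PropositionalEquality using (_≡_)
open import Algebra.Bundles using (CommutativeRing)
open import Data.Product using (∃; _×_; _,_; proj₁; proj₂)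
open import Data.Sum using (inj₁; inj₂)
open import Relation.Nullary using (¬_; yes; no; contradiction)
open import Relation.Binary.Bundles using (Setoid)
open import Relation.Binary.Definitions using (Decidable)
open import Function.Properties.Inverse using (Inverse⇒Injection)
open import Data.Fin.Properties using (inj⇒≟)
import Algebra.Properties.Group as GroupProperties
import Algebra.Properties.CommutativeSemigroup as CommutativeSemigroupProperties
import Relation.Binary.Reasoning.Setoid as SetoidReasoning

module _ {r ℓ : Level} (R : CommutativeRing r ℓ) where
  open CommutativeRing R
  open GroupProperties +-group
    using (identityʳ-unique; x∙y⁻¹≈ε⇒x≈y; x≈y⇒x∙y⁻¹≈ε; //-rightDividesˡ)
  open CommutativeSemigroupProperties *-commutativeSemigroup using (x∙yz≈y∙xz; xy∙z≈y∙xz)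

  infix  4 _≃_
  infixr 6 _⊕_
  infixr 7 _·_

  _≃_ : E R → E R → Set ℓ
  _≃_ = _≈E_ R

  _⊕_ : E R → E R → E R
  _⊕_ = _+E_ R

  _·_ : Carrier → E R → E R
  a · X = ⟨ a * e₁ X , a * e₂ X , a * e₃ X ⟩

  ≃-setoid : Setoid r ℓ
  ≃-setoid = record
    { Carrier       = E R
    ; _≈_           = _≃_
    ; isEquivalence = record
      { refl  = refl , refl , refl
      ; sym   = λ (p₁ , p₂ , p₃) → sym p₁ , sym p₂ , sym p₃
      ; trans = λ (p₁ , p₂ , p₃) (q₁ , q₂ , q₃) → trans p₁ q₁ , trans p₂ q₂ , trans p₃ q₃
      }
    }

  module ≃-Reasoning = SetoidReasoning ≃-setoid
  open Setoid ≃-setoid using () renaming (refl to ≃-refl; sym to ≃-sym; trans to ≃-trans)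

  ≈P-sym : ∀ {z z' : Pt R} → _≈P_ R z z' → _≈P_ R z' z
  ≈P-sym (p , q) = ≃-sym p , ≃-sym q

  ≈P-trans : ∀ {z z' z'' : Pt R} → _≈P_ R z z' → _≈P_ R z' z'' → _≈P_ R z z''
  ≈P-trans (p , q) (p' , q') = ≃-trans p p' , ≃-trans q q'

  scal-cong : ∀ {a b} → a ≈ b → scal R a ≃ scal R b
  scal-cong p = p , refl , refl

  ⊕-cong : ∀ {X X' Y Y'} → X ≃ X' → Y ≃ Y' → X ⊕ Y ≃ X' ⊕ Y'
  ⊕-cong (p₁ , p₂ , p₃) (q₁ , q₂ , q₃) = +-cong p₁ q₁ , +-cong p₂ q₂ , +-cong p₃ q₃

  ·-congˡ : ∀ {a X Y} → X ≃ Y → a · X ≃ a · Y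
  ·-congˡ (p₁ , p₂ , p₃) = *-congˡ p₁ , *-congˡ p₂ , *-congˡ p₃

  ·-identityˡ : ∀ X → 1# · X ≃ X
  ·-identityˡ X = *-identityˡ _ , *-identityˡ _ , *-identityˡ _

  ·-zeroˡ-⊕ : ∀ X Y → 0# · X ⊕ Y ≃ Y
  ·-zeroˡ-⊕ X Y = 0*x+y≈y , 0*x+y≈y , 0*x+y≈y
    where
    0*x+y≈y : ∀ {x y} → 0# * x + y ≈ y
    0*x+y≈y = trans (+-congʳ (zeroˡ _)) (+-identityˡ _)

  y≈0⇒x+y≈x : ∀ {x y} → y ≈ 0# → x + y ≈ x
  y≈0⇒x+y≈x p = trans (+-congˡ p) (+-identityʳ _)

  b*0+e≈e : ∀ b e → b * 0# + e ≈ e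
  b*0+e≈e b e = trans (+-congʳ (zeroʳ b)) (+-identityˡ e)

  b*1+0≈b : ∀ b → b * 1# + 0# ≈ b
  b*1+0≈b b = trans (+-identityʳ _) (*-identityʳ b)

  mulE-congˡ : ∀ δ {X Y Z} → X ≃ Y → mulE R δ X Z ≃ mulE R δ Y Z
  mulE-congˡ δ (p₁ , p₂ , p₃) =
    +-cong (*-congʳ p₁) (*-congˡ (+-cong (*-congʳ p₂) (*-congʳ p₃))) ,
    +-cong (+-cong (*-congʳ p₁) (*-congʳ p₂)) (*-congˡ (*-congʳ p₃)) ,
    +-cong (+-cong (*-congʳ p₁) (*-congʳ p₂)) (*-congʳ p₃)

  mulE-scalˡ : ∀ δ a X → mulE R δ (scal R a) X ≃ a · X
  mulE-scalˡ δ a X =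
    y≈0⇒x+y≈x (trans (*-congˡ (trans (+-cong (zeroˡ _) (zeroˡ _)) (+-identityʳ 0#))) (zeroʳ δ)) ,
    trans (y≈0⇒x+y≈x (trans (*-congˡ (zeroˡ _)) (zeroʳ δ))) (y≈0⇒x+y≈x (zeroˡ _)) ,
    trans (y≈0⇒x+y≈x (zeroˡ _)) (y≈0⇒x+y≈x (zeroˡ _))

  -- The let-bound numerator/denominator of Defs.Acts, so that Acts unfolds to statements about lin.
  lin : Carrier → Carrier → Carrier → Carrier → Pt R → E R
  lin δ a b e (α , β) = mulE R δ (scal R a) α ⊕ (mulE R δ (scal R b) β ⊕ scal R e)

  lin-cong : ∀ δ {a a' b b' e e'} z → a ≈ a' → b ≈ b' → e ≈ e' → lin δ a b e z ≃ lin δ a' b' e' z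
  lin-cong δ _ p q s =
    ⊕-cong (mulE-congˡ δ (scal-cong p)) (⊕-cong (mulE-congˡ δ (scal-cong q)) (scal-cong s))

  lin-affine : ∀ δ a b e z → lin δ a b e z ≃ a · proj₁ z ⊕ b · proj₂ z ⊕ scal R e
  lin-affine δ a b e (α , β) = ⊕-cong (mulE-scalˡ δ a α) (⊕-cong (mulE-scalˡ δ b β) ≃-refl)

  lin-second-row : ∀ δ c b z → lin δ 0# c b z ≃ c · proj₂ z ⊕ scal R b
  lin-second-row δ c b z = ≃-trans (lin-affine δ 0# c b z) (·-zeroˡ-⊕ _ _)

  lin-third-row : ∀ δ d z → lin δ 0# 0# d z ≃ scal R d
  lin-third-row δ d z = ≃-trans (lin-second-row δ 0# d z) (·-zeroˡ-⊕ _ _)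

  record UpperMove (z z' : Pt R) : Set (r ⊔ ℓ) where
    field
      c d b x y : Carrier
      c≉0 : c ≉ 0#
      d≉0 : d ≉ 0#
      first  : d · proj₁ z' ≃ d · proj₁ z ⊕ y · proj₂ z ⊕ scal R x
      second : d · proj₂ z' ≃ c · proj₂ z ⊕ scal R b

  sameOrbit⇒upperMove : ∀ δ {z z'} → SameOrbit R δ z z' → UpperMove z z'
  sameOrbit⇒upperMove δ {z} {z'}
    (g , (c , d , b , x , y , c≉0 , d≉0 , g₁₁ , g₁₂ , g₁₃ , g₂₁ , g₂₂ , g₂₃ , g₃₁ , g₃₂ , g₃₃) ,
     _ , num₁ , num₂) =
    record { c = c ; d = d ; b = b ; x = x ; y = y ; c≉0 = c≉0 ; d≉0 = d≉0
           ; first = first ; second = second }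
    where
    open ≃-Reasoning
    cleared : ∀ Z → d · Z ≃ mulE R δ (lin δ (m₃₁ g) (m₃₂ g) (m₃₃ g) z) Z
    cleared Z = ≃-sym (≃-trans (mulE-congˡ δ
      (≃-trans (lin-cong δ z g₃₁ g₃₂ g₃₃) (lin-third-row δ d z))) (mulE-scalˡ δ d Z))
    first : d · proj₁ z' ≃ d · proj₁ z ⊕ y · proj₂ z ⊕ scal R x
    first = begin
      d · proj₁ z'                          ≈⟨ cleared (proj₁ z') ⟩
      _                                     ≈⟨ num₁ ⟩
      lin δ (m₁₁ g) (m₁₂ g) (m₁₃ g) z       ≈⟨ lin-cong δ z g₁₁ g₁₂ g₁₃ ⟩
      lin δ d y x z                         ≈⟨ lin-affine δ d y x z ⟩
      d · proj₁ z ⊕ y · proj₂ z ⊕ scal R x  ∎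
    second : d · proj₂ z' ≃ c · proj₂ z ⊕ scal R b
    second = begin
      d · proj₂ z'                          ≈⟨ cleared (proj₂ z') ⟩
      _                                     ≈⟨ num₂ ⟩
      lin δ (m₂₁ g) (m₂₂ g) (m₂₃ g) z       ≈⟨ lin-cong δ z g₂₁ g₂₂ g₂₃ ⟩
      lin δ 0# c b z                        ≈⟨ lin-second-row δ c b z ⟩
      c · proj₂ z ⊕ scal R b                ∎

  upperMove⇒sameOrbit : ∀ δ {z z'} → UpperMove z z' → SameOrbit R δ z z'
  upperMove⇒sameOrbit δ {z} {z'} m =
    mat d y x 0# c b 0# 0# d ,
    (c , d , b , x , y , c≉0 , d≉0 , refl , refl , refl , refl , refl , refl , refl , refl , refl) ,
    (λ den≃0 → d≉0 (proj₁ (≃-trans (≃-sym (lin-third-row δ d z)) den≃0))) ,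
    ≃-trans cleared (≃-trans first (≃-sym (lin-affine δ d y x z))) ,
    ≃-trans cleared (≃-trans second (≃-sym (lin-second-row δ c b z)))
    where
    open UpperMove m
    cleared : ∀ {Z} → mulE R δ (lin δ 0# 0# d z) Z ≃ d · Z
    cleared = ≃-trans (mulE-congˡ δ (lin-third-row δ d z)) (mulE-scalˡ δ d _)

  upperMove-resp : ∀ {z₁ z₂ z₁' z₂'} → _≈P_ R z₁ z₂ → _≈P_ R z₁' z₂' →
                   UpperMove z₁ z₁' → UpperMove z₂ z₂'
  upperMove-resp (α₁≃α₂ , β₁≃β₂) (α₁'≃α₂' , β₁'≃β₂') m = record
    { c = c ; d = d ; b = b ; x = x ; y = y ; c≉0 = c≉0 ; d≉0 = d≉0
    ; first  = ≃-trans (·-congˡ (≃-sym α₁'≃α₂'))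
                 (≃-trans first (⊕-cong (·-congˡ α₁≃α₂) (⊕-cong (·-congˡ β₁≃β₂) ≃-refl)))
    ; second = ≃-trans (·-congˡ (≃-sym β₁'≃β₂'))
                 (≃-trans second (⊕-cong (·-congˡ β₁≃β₂) ≃-refl))
    }
    where open UpperMove m

  D₁ : Carrier → Carrier → Pt R
  D₁ u v = ⟨ 0# , u , 0# ⟩ , ⟨ 0# , v , 1# ⟩

  D₂ : Carrier → Pt R
  D₂ u = ⟨ 0# , 1# , u ⟩ , ⟨ 0# , 1# , 0# ⟩

  minor : Pt R → Carrier
  minor (α , β) = e₂ α * e₃ β - e₃ α * e₂ β

  minor-cong : ∀ {z z'} → _≈P_ R z z' → minor z ≈ minor z'
  minor-cong ((_ , α₂ , α₃) , (_ , β₂ , β₃)) = +-cong (*-cong α₂ β₃) (-‿cong (*-cong α₃ β₂))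

  inH-resp : ∀ {z z'} → _≈P_ R z z' → InH R z → InH R z'
  inH-resp z≈z' inH minor≈0 = inH (trans (minor-cong z≈z') minor≈0)

  D₁-inH : ∀ {u} v → u ≉ 0# → InH R (D₁ u v)
  D₁-inH v u≉0 minor≈0 =
    u≉0 (trans (sym (*-identityʳ _)) (trans (x∙y⁻¹≈ε⇒x≈y _ _ minor≈0) (zeroˡ v)))

  D₂-inH : ∀ {u} → u ≉ 0# → InH R (D₂ u)
  D₂-inH u≉0 minor≈0 =
    u≉0 (trans (sym (*-identityʳ _)) (trans (sym (x∙y⁻¹≈ε⇒x≈y _ _ minor≈0)) (zeroʳ 1#)))

  inD⇒inH : ∀ w → InD R w → InH R w
  inD⇒inH w (inj₁ (u , v , u≉0 , w≈D₁)) = inH-resp (≈P-sym w≈D₁) (D₁-inH v u≉0)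
  inD⇒inH w (inj₂ (u , u≉0 , w≈D₂))     = inH-resp (≈P-sym w≈D₂) (D₂-inH u≉0)

  module _ (isField : IsFieldCR R) where

    1≉0 : 1# ≉ 0#
    1≉0 1≈0 = proj₁ isField (sym 1≈0)

    *-cancelˡ-≉0 : ∀ {d a b} → d ≉ 0# → d * a ≈ d * b → a ≈ b
    *-cancelˡ-≉0 {d} {a} {b} d≉0 da≈db = begin
      a                ≈⟨ *-identityˡ a ⟨
      1# * a           ≈⟨ *-congʳ dd⁻¹≈1 ⟨
      d * d⁻¹ * a      ≈⟨ xy∙z≈y∙xz d d⁻¹ a ⟩
      d⁻¹ * (d * a)    ≈⟨ *-congˡ da≈db ⟩
      d⁻¹ * (d * b)    ≈⟨ xy∙z≈y∙xz d d⁻¹ b ⟨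
      d * d⁻¹ * b      ≈⟨ *-congʳ dd⁻¹≈1 ⟩
      1# * b           ≈⟨ *-identityˡ b ⟩
      b                ∎
      where
      open SetoidReasoning setoid
      d⁻¹ = proj₁ (proj₂ isField d d≉0)
      dd⁻¹≈1 = proj₂ (proj₂ isField d d≉0)

    D₁-upperMove-D₁ : ∀ {u v u' v'} → UpperMove (D₁ u v) (D₁ u' v') → _≈P_ R (D₁ u v) (D₁ u' v')
    D₁-upperMove-D₁ {u} {v} m = (refl , u≈u' , refl) , (refl , v≈v' , refl)
      where
      open UpperMove m
      y≈0 : y ≈ 0#
      y≈0 = trans (sym (b*1+0≈b y)) (identityʳ-unique _ _ (sym (proj₂ (proj₂ first))))
      u≈u' = *-cancelˡ-≉0 d≉0 (sym (trans (proj₁ (proj₂ first))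
               (y≈0⇒x+y≈x (trans (+-identityʳ _) (trans (*-congʳ y≈0) (zeroˡ v))))))
      d≈c : d ≈ c
      d≈c = trans (sym (*-identityʳ d)) (trans (proj₂ (proj₂ second)) (b*1+0≈b c))
      v≈v' = *-cancelˡ-≉0 d≉0 (trans (*-congʳ d≈c) (sym (trans (proj₁ (proj₂ second)) (+-identityʳ _))))

    ¬D₁-upperMove-D₂ : ∀ {u v u'} → ¬ UpperMove (D₁ u v) (D₂ u')
    ¬D₁-upperMove-D₂ m = c≉0 (trans (sym (b*1+0≈b c)) (trans (sym (proj₂ (proj₂ second))) (zeroʳ d)))
      where open UpperMove m

    ¬D₂-upperMove-D₁ : ∀ {u u' v'} → ¬ UpperMove (D₂ u) (D₁ u' v')
    ¬D₂-upperMove-D₁ m = d≉0 (trans (sym (*-identityʳ d)) (trans (proj₂ (proj₂ second)) (b*0+e≈e c 0#)))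
      where open UpperMove m

    D₂-upperMove-D₂ : ∀ {u u'} → UpperMove (D₂ u) (D₂ u') → _≈P_ R (D₂ u) (D₂ u')
    D₂-upperMove-D₂ m = (refl , refl , u≈u') , ≃-refl
      where
      open UpperMove m
      u≈u' = *-cancelˡ-≉0 d≉0 (sym (trans (proj₂ (proj₂ first)) (y≈0⇒x+y≈x (b*0+e≈e y 0#))))

    inD-upperMove-unique : ∀ w w' → InD R w → InD R w' → UpperMove w w' → _≈P_ R w w'
    inD-upperMove-unique w w' (inj₁ (_ , _ , _ , w≈D)) (inj₁ (_ , _ , _ , w'≈D')) m =
      ≈P-trans w≈D (≈P-trans (D₁-upperMove-D₁ (upperMove-resp w≈D w'≈D' m)) (≈P-sym w'≈D'))
    inD-upperMove-unique w w' (inj₁ (_ , _ , _ , w≈D)) (inj₂ (_ , _ , w'≈D')) m =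
      contradiction (upperMove-resp w≈D w'≈D' m) ¬D₁-upperMove-D₂
    inD-upperMove-unique w w' (inj₂ (_ , _ , w≈D)) (inj₁ (_ , _ , _ , w'≈D')) m =
      contradiction (upperMove-resp w≈D w'≈D' m) ¬D₂-upperMove-D₁
    inD-upperMove-unique w w' (inj₂ (_ , _ , w≈D)) (inj₂ (_ , _ , w'≈D')) m =
      ≈P-trans w≈D (≈P-trans (D₂-upperMove-D₂ (upperMove-resp w≈D w'≈D' m)) (≈P-sym w'≈D'))

    unipotentMove : ∀ {w z} c b x y → c ≉ 0# →
                    proj₁ z ≃ proj₁ w ⊕ y · proj₂ w ⊕ scal R x →
                    proj₂ z ≃ c · proj₂ w ⊕ scal R b → UpperMove w z
    unipotentMove {w} {z} c b x y c≉0 α≃ β≃ = record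
      { c = c ; d = 1# ; b = b ; x = x ; y = y ; c≉0 = c≉0 ; d≉0 = 1≉0
      ; first  = ≃-trans (·-identityˡ (proj₁ z))
                   (≃-trans α≃ (⊕-cong (≃-sym (·-identityˡ (proj₁ w))) ≃-refl))
      ; second = ≃-trans (·-identityˡ (proj₂ z)) β≃
      }

    -- With β₃ ≠ 0 take v = β₂/β₃, so that β = β₃·(v δ^{1/3} + δ^{2/3}) + β₁, and u = α₂ − α₃ v.
    cover-D₁ : ∀ α β → InH R (α , β) → e₃ β ≉ 0# →
               ∃ λ u → ∃ λ v → u ≉ 0# × UpperMove (D₁ u v) (α , β)
    cover-D₁ ⟨ α₁ , α₂ , α₃ ⟩ ⟨ β₁ , β₂ , β₃ ⟩ inH β₃≉0 =
      u , v , u≉0 ,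
      unipotentMove β₃ β₁ α₁ α₃ β₃≉0
        ( sym (trans (+-identityˡ _) (b*0+e≈e α₃ α₁))
        , sym (trans (+-congˡ (+-identityʳ _)) (//-rightDividesˡ (α₃ * v) α₂))
        , sym (trans (+-identityˡ _) (b*1+0≈b α₃)) )
        (sym (b*0+e≈e β₃ β₁) , sym (trans (+-identityʳ _) β₃v≈β₂) , sym (b*1+0≈b β₃))
      where
      β₃⁻¹ = proj₁ (proj₂ isField β₃ β₃≉0)
      v = β₂ * β₃⁻¹
      u = α₂ - α₃ * v
      β₃v≈β₂ : β₃ * v ≈ β₂
      β₃v≈β₂ = trans (x∙yz≈y∙xz β₃ β₂ β₃⁻¹)
                 (trans (*-congˡ (proj₂ (proj₂ isField β₃ β₃≉0))) (*-identityʳ β₂))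
      u≉0 : u ≉ 0#
      u≉0 u≈0 = inH (x≈y⇒x∙y⁻¹≈ε (begin
        α₂ * β₃          ≈⟨ *-congʳ (x∙y⁻¹≈ε⇒x≈y α₂ (α₃ * v) u≈0) ⟩
        α₃ * v * β₃      ≈⟨ *-assoc α₃ v β₃ ⟩
        α₃ * (v * β₃)    ≈⟨ *-congˡ (trans (*-comm v β₃) β₃v≈β₂) ⟩
        α₃ * β₂          ∎))
        where open SetoidReasoning setoid

    cover-D₂ : ∀ α β → InH R (α , β) → e₃ β ≈ 0# →
               ∃ λ u → u ≉ 0# × UpperMove (D₂ u) (α , β)
    cover-D₂ ⟨ α₁ , α₂ , α₃ ⟩ ⟨ β₁ , β₂ , β₃ ⟩ inH β₃≈0 =
      α₃ , α₃≉0 ,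
      unipotentMove β₂ β₁ α₁ (α₂ - 1#) β₂≉0
        ( sym (trans (+-identityˡ _) (b*0+e≈e _ α₁))
        , sym (trans (+-congˡ (b*1+0≈b _)) (trans (+-comm 1# _) (//-rightDividesˡ 1# α₂)))
        , sym (y≈0⇒x+y≈x (b*0+e≈e _ 0#)) )
        (sym (b*0+e≈e β₂ β₁) , sym (b*1+0≈b β₂) , trans β₃≈0 (sym (b*0+e≈e β₂ 0#)))
      where
      α₂β₃≈0 : α₂ * β₃ ≈ 0#
      α₂β₃≈0 = trans (*-congˡ β₃≈0) (zeroʳ α₂)
      α₃≉0 : α₃ ≉ 0#
      α₃≉0 α₃≈0 = inH (x≈y⇒x∙y⁻¹≈ε (trans α₂β₃≈0 (sym (trans (*-congʳ α₃≈0) (zeroˡ β₂)))))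
      β₂≉0 : β₂ ≉ 0#
      β₂≉0 β₂≈0 = inH (x≈y⇒x∙y⁻¹≈ε (trans α₂β₃≈0 (sym (trans (*-congˡ β₂≈0) (zeroʳ α₃)))))

    inD-upperMove-exists : Decidable _≈_ → ∀ z → InH R z → ∃ λ w → InD R w × UpperMove w z
    inD-upperMove-exists _≟_ (α , β) inH with e₃ β ≟ 0#
    ... | no β₃≉0 = let u , v , u≉0 , m = cover-D₁ α β inH β₃≉0
                    in D₁ u v , inj₁ (u , v , u≉0 , ≃-refl , ≃-refl) , m
    ... | yes β₃≈0 = let u , u≉0 , m = cover-D₂ α β inH β₃≈0
                     in D₂ u , inj₂ (u , u≉0 , ≃-refl , ≃-refl) , m

    fundamentalDomain : Decidable _≈_ → ∀ δ → FundamentalDomain R δ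
    fundamentalDomain _≟_ δ =
      inD⇒inH ,
      (λ z inH → let w , w∈D , m = inD-upperMove-exists _≟_ z inH
                 in w , w∈D , upperMove⇒sameOrbit δ m) ,
      (λ w w' w∈D w'∈D orbit → inD-upperMove-unique w w' w∈D w'∈D (sameOrbit⇒upperMove δ orbit))

proposition5p1 : {c ℓ : Level} (p n q : ℕ) → Prime p → q ≡ p ^ n → q % 3 ≡ 1 →
    (R : CommutativeRing c ℓ) → IsFieldCR R → HasCard R q →
    (δ : CommutativeRing.Carrier R) → CubicNonresidue R δ →
    FundamentalDomain R δ
proposition5p1 _ _ _ _ _ _ R isField card δ _ =
  fundamentalDomain R isField (inj⇒≟ (Inverse⇒Injection card)) δ
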